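{- Let $G$ be a finite simple graph and $k$ a positive integer. Let $G'$ be the graph obtained from $G$ by adding a vertex-disjoint copy of the complete bipartite graph $K_{k-1,2k}$, and let $G^\phi_k$ be the complement of $G'$. Then $G$ contains $K_{k,k}$ as a subgraph if and only if $\widetilde{\alpha}(G^\phi_k)\ge 2k$.
   Context: For non-negative integers $s,t$, an $(s,t)$-bipartite-hole in a graph $F$ consists of two disjoint vertex sets $S,T$ with $|S|=s$, $|T|=t$ and no edge of $F$ between $S$ and $T$. The bipartite-hole-number $\widetilde{\alpha}(F)$ is the least integer $r$ which can be written as $r=s+t-1$ for some positive integers $s,t$ such that $F$ contains no $(s,t)$-bipartite-hole (equivalently, the maximum $r$ such that $F$ has an $(s,t)$-bipartite-hole for all non-negative integers $s,t$ with $s+t=r$). -}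

module Defs where

open import Data.Nat using (ℕ; suc; _+_; _∸_; _*_; _≤_)
open import Data.Bool using (Bool; true; false; not; _∧_; _xor_)
open import Data.Bool.Properties using (xor-same)
open import Data.Fin using (Fin; splitAt; _≟_)
open import Data.Fin.Subset using (Subset; _∈_; ∣_∣)
open import Data.Sum using (_⊎_; inj₁; inj₂)
open import Data.Product using (Σ; _×_; ∃; ∃-syntax; _,_)
open import Data.Empty using (⊥)
open import Function.Definitions using (Injective)
open import Relation.Nullary using (¬_; does; yes; no)
open import Relation.Binary.PropositionalEquality using (_≡_; _≢_; refl)

record SimpleGraph (n : ℕ) : Set where
  field
    adj    : Fin n → Fin n → Bool
    sym    : ∀ u v → adj u v ≡ adj v u
    irrefl : ∀ v → adj v v ≡ false
open SimpleGraph public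

private
  adj⊎ : ∀ {n m} → SimpleGraph n → SimpleGraph m → Fin n ⊎ Fin m → Fin n ⊎ Fin m → Bool
  adj⊎ G H (inj₁ i) (inj₁ j) = adj G i j
  adj⊎ G H (inj₂ i) (inj₂ j) = adj H i j
  adj⊎ G H (inj₁ i) (inj₂ j) = false
  adj⊎ G H (inj₂ i) (inj₁ j) = false

  adj⊎-sym : ∀ {n m} (G : SimpleGraph n) (H : SimpleGraph m) x y → adj⊎ G H x y ≡ adj⊎ G H y x
  adj⊎-sym G H (inj₁ i) (inj₁ j) = sym G i j
  adj⊎-sym G H (inj₂ i) (inj₂ j) = sym H i j
  adj⊎-sym G H (inj₁ i) (inj₂ j) = refl
  adj⊎-sym G H (inj₂ i) (inj₁ j) = refl

  adj⊎-irrefl : ∀ {n m} (G : SimpleGraph n) (H : SimpleGraph m) x → adj⊎ G H x x ≡ false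
  adj⊎-irrefl G H (inj₁ i) = irrefl G i
  adj⊎-irrefl G H (inj₂ i) = irrefl H i

_⊕_ : ∀ {n m} → SimpleGraph n → SimpleGraph m → SimpleGraph (n + m)
_⊕_ {n} G H = record
  { adj    = λ u v → adj⊎ G H (splitAt n u) (splitAt n v)
  ; sym    = λ u v → adj⊎-sym G H (splitAt n u) (splitAt n v)
  ; irrefl = λ v → adj⊎-irrefl G H (splitAt n v)
  }

-- Complete bipartite graph K_{a,b} on Fin (a + b): first a vertices form one side.
private
  side : ∀ {a b} → Fin a ⊎ Fin b → Bool
  side (inj₁ _) = true
  side (inj₂ _) = false

  xor-comm' : ∀ x y → x xor y ≡ y xor x
  xor-comm' true true = refl
  xor-comm' true false = refl
  xor-comm' false true = refl
  xor-comm' false false = refl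

K : (a b : ℕ) → SimpleGraph (a + b)
K a b = record
  { adj    = λ u v → side {a} {b} (splitAt a u) xor side {a} {b} (splitAt a v)
  ; sym    = λ u v → xor-comm' (side {a} {b} (splitAt a u)) (side {a} {b} (splitAt a v))
  ; irrefl = λ v → xor-same (side {a} {b} (splitAt a v))
  }

private
  ≟-sym : ∀ {n} (u v : Fin n) → does (u ≟ v) ≡ does (v ≟ u)
  ≟-sym u v with u ≟ v | v ≟ u
  ... | yes _ | yes _ = refl
  ... | no _  | no _  = refl
  ... | yes refl | no q = Data.Empty.⊥-elim (q refl)
    where import Data.Empty
  ... | no p | yes refl = Data.Empty.⊥-elim (p refl)
    where import Data.Empty

  ≟-refl : ∀ {n} (v : Fin n) → does (v ≟ v) ≡ true
  ≟-refl v with v ≟ v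
  ... | yes _ = refl
  ... | no p = Data.Empty.⊥-elim (p refl)
    where import Data.Empty

  ∧-not-true : ∀ x → x ∧ not true ≡ false
  ∧-not-true true = refl
  ∧-not-true false = refl

complement : ∀ {n} → SimpleGraph n → SimpleGraph n
complement G = record
  { adj    = λ u v → not (adj G u v) ∧ not (does (u ≟ v))
  ; sym    = λ u v → helper u v
  ; irrefl = λ v → irr v
  }
  where
    open import Relation.Binary.PropositionalEquality using (cong₂)
    helper : ∀ u v → not (adj G u v) ∧ not (does (u ≟ v)) ≡ not (adj G v u) ∧ not (does (v ≟ u))
    helper u v = cong₂ (λ a b → not a ∧ not b) (sym G u v) (≟-sym u v)
    irr : ∀ v → not (adj G v v) ∧ not (does (v ≟ v)) ≡ false
    irr v with does (v ≟ v) | ≟-refl v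
    ... | .true | refl = ∧-not-true (not (adj G v v))

ContainsKkk : ∀ {n} → SimpleGraph n → ℕ → Set
ContainsKkk {n} G k =
  Σ (Fin k → Fin n) λ f → Σ (Fin k → Fin n) λ g →
    Injective _≡_ _≡_ f × Injective _≡_ _≡_ g ×
    (∀ i j → f i ≢ g j) × (∀ i j → adj G (f i) (g j) ≡ true)

HasBipartiteHole : ∀ {n} → SimpleGraph n → ℕ → ℕ → Set
HasBipartiteHole {n} F s t =
  Σ (Subset n) λ S → Σ (Subset n) λ T →
    ∣ S ∣ ≡ s × ∣ T ∣ ≡ t ×
    (∀ v → v ∈ S → v ∈ T → ⊥) ×
    (∀ u v → u ∈ S → v ∈ T → adj F u v ≡ false)

IsBipartiteHoleNumber : ∀ {n} → SimpleGraph n → ℕ → Set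
IsBipartiteHoleNumber F r =
  (∃[ s ] ∃[ t ] (1 ≤ s × 1 ≤ t × r ≡ s + t ∸ 1 × ¬ HasBipartiteHole F s t)) ×
  (∀ s t → 1 ≤ s → 1 ≤ t → ¬ HasBipartiteHole F s t → r ≤ s + t ∸ 1)

Gphi : ∀ {n} → SimpleGraph n → (k : ℕ) → SimpleGraph (n + ((k ∸ 1) + 2 * k))
Gphi G k = complement (G ⊕ K (k ∸ 1) (2 * k))

-- Holes of a complement are the bicliques of the graph, so the question is
-- whether G ⊕ K_{k-1,2k} contains K_{s,t} for all s + t ≤ 2k.  If G ⊇ K_{k,k},
-- balanced pairs (s, t ≤ k) are served by G, and a lopsided pair (one side
-- > k, hence the other ≤ k - 1) by K_{k-1,2k}.  Conversely a K_{k,k} in the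
-- disjoint union is connected, so it lies in G or in K_{k-1,2k}; in the latter
-- one of its sides would fall into the part of size k - 1.

module Submission where

open import Defs
open import Data.Nat using (ℕ; _≤_; _*_)
open import Data.Product using (Σ; _×_)
open import Function.Bundles using (_⇔_)

open import Data.Nat using (zero; suc; _+_; _∸_; _<_; z≤n; s≤s; _≤?_)
import Data.Nat as ℕ
open import Data.Nat.Properties
  using (≤-refl; ≤-trans; m≤m+n; m≤n+m; +-suc; +-comm; +-identityʳ; +-monoʳ-≤;
         +-cancelʳ-≤; m+n∸n≡m; 1+n≰n; ≰⇒>; ≮⇒≥; <⇒≤pred; m<1+n⇒m<n∨m≡n; module ≤-Reasoning)
import Data.Bool as Bool
open import Data.Bool using (true; false)
open import Data.Fin using (Fin; zero; suc; toℕ; fromℕ<; splitAt; _↑ˡ_; _↑ʳ_; inject≤; _≟_)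
open import Data.Fin.Properties
  using (↑ˡ-injective; ↑ʳ-injective; inject≤-injective; splitAt-↑ˡ; splitAt-↑ʳ;
         splitAt⁻¹-↑ˡ; splitAt⁻¹-↑ʳ; suc-injective; injective⇒≤; toℕ≤pred[n]; toℕ-fromℕ<;
         any?; all?)
open import Data.Fin.Subset using (Subset; _∈_; _∉_; ∣_∣; ⁅_⁆; _∪_; inside; outside)
import Data.Fin.Subset as Subset
open import Data.Fin.Subset.Properties
  using (x∈p∪q⁻; x∈⁅y⁆⇒x≡y; ∉⊥; ∣⊥∣≡0; ∪-identityˡ; ∣p∣≤n; _∈?_; anySubset?)
open import Data.Vec.Base using (_∷_; here; there)
open import Data.Sum using (_⊎_; inj₁; inj₂; [_,_]′)
open import Data.Product using (∃; ∃-syntax; _,_; proj₁; proj₂)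
open import Data.Empty using (⊥; ⊥-elim)
open import Function using (_∘_; id; mk⇔)
open import Function.Definitions using (Injective)
open import Relation.Unary using (Decidable)
open import Relation.Nullary using (¬_; Dec; yes; no; contradiction)
open import Relation.Nullary.Decidable using (_×-dec_; _→-dec_; ¬?; map′; decidable-stable)
open import Relation.Binary.PropositionalEquality as ≡
  using (_≡_; _≢_; refl; trans; cong; cong₂; subst)

variable
  n m N s t s′ t′ k : ℕ
  G H : SimpleGraph n
  u v : Fin N

IsBiclique : SimpleGraph N → (Fin s → Fin N) → (Fin t → Fin N) → Set
IsBiclique H f g =
  Injective _≡_ _≡_ f × Injective _≡_ _≡_ g ×
  (∀ i j → f i ≢ g j) × (∀ i j → adj H (f i) (g j) ≡ true)

Biclique : SimpleGraph N → ℕ → ℕ → Set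
Biclique {N} H s t = Σ (Fin s → Fin N) λ f → Σ (Fin t → Fin N) λ g → IsBiclique H f g

Biclique-swap : (H : SimpleGraph N) → Biclique H s t → Biclique H t s
Biclique-swap H (f , g , f-inj , g-inj , f≢g , f~g) =
  g , f , g-inj , f-inj , (λ j i → f≢g i j ∘ ≡.sym) , λ j i → trans (sym H (g j) (f i)) (f~g i j)

Biclique-shrink : (H : SimpleGraph N) → s′ ≤ s → t′ ≤ t → Biclique H s t → Biclique H s′ t′
Biclique-shrink H s′≤s t′≤t (f , g , f-inj , g-inj , f≢g , f~g) =
  (λ i → f (inject≤ i s′≤s)) , (λ j → g (inject≤ j t′≤t)) ,
  inject≤-injective s′≤s s′≤s _ _ ∘ f-inj , inject≤-injective t′≤t t′≤t _ _ ∘ g-inj ,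
  (λ i j → f≢g _ _) , λ i j → f~g _ _

InImage : (Fin n → Fin N) → Fin N → Set
InImage φ u = ∃ λ x → φ x ≡ u

factor-injective : {φ : Fin n → Fin N} {f : Fin s → Fin N} →
  Injective _≡_ _≡_ f → (im : ∀ i → InImage φ (f i)) → Injective _≡_ _≡_ (proj₁ ∘ im)
factor-injective {φ = φ} f-inj im {i} {j} eq =
  f-inj (trans (≡.sym (proj₂ (im i))) (trans (cong φ eq) (proj₂ (im j))))

record Embedding (G : SimpleGraph n) (H : SimpleGraph N) : Set where
  field
    embed     : Fin n → Fin N
    injective : Injective _≡_ _≡_ embed
    adj-embed : ∀ x y → adj H (embed x) (embed y) ≡ adj G x y

Biclique-map : Embedding G H → Biclique G s t → Biclique H s t
Biclique-map e (f , g , f-inj , g-inj , f≢g , f~g) =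
  embed ∘ f , embed ∘ g , f-inj ∘ injective , g-inj ∘ injective ,
  (λ i j → f≢g i j ∘ injective) , λ i j → trans (adj-embed (f i) (g j)) (f~g i j)
  where open Embedding e

Biclique-reflect : (e : Embedding G H) {f : Fin s → Fin N} {g : Fin t → Fin N} →
  IsBiclique H f g →
  (∀ i → InImage (Embedding.embed e) (f i)) → (∀ j → InImage (Embedding.embed e) (g j)) →
  Biclique G s t
Biclique-reflect {H = H} e (f-inj , g-inj , f≢g , f~g) imf img =
  proj₁ ∘ imf , proj₁ ∘ img , factor-injective f-inj imf , factor-injective g-inj img ,
  (λ i j eq → f≢g i j (trans (≡.sym (proj₂ (imf i))) (trans (cong embed eq) (proj₂ (img j))))) ,
  λ i j → trans (≡.sym (adj-embed _ _))
                (trans (cong₂ (adj H) (proj₂ (imf i)) (proj₂ (img j))) (f~g i j))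
  where open Embedding e

-- A biclique with a nonempty side is connected, so one vertex fixes the side of all others.
biclique-sides : (H : SimpleGraph N) {P Q : Fin N → Set} →
  (∀ {u v} → P u → adj H u v ≡ true → Q v) → (∀ {u v} → Q u → adj H u v ≡ true → P v) →
  {f : Fin s → Fin N} {g : Fin (suc t) → Fin N} → (∀ i j → adj H (f i) (g j) ≡ true) →
  ∀ {i₀} → P (f i₀) → (∀ i → P (f i)) × (∀ j → Q (g j))
biclique-sides H {Q = Q} P⇒Q Q⇒P {f} {g} f~g p =
  (λ i → Q⇒P (g∈Q zero) (trans (sym H _ _) (f~g i zero))) , g∈Q
  where
  g∈Q : ∀ j → Q (g j)
  g∈Q j = P⇒Q p (f~g _ j)

summand : ∀ n {m} (u : Fin (n + m)) → InImage (_↑ˡ m) u ⊎ InImage (n ↑ʳ_) u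
summand n u with splitAt n u in eq
... | inj₁ x = inj₁ (x , splitAt⁻¹-↑ˡ eq)
... | inj₂ y = inj₂ (y , splitAt⁻¹-↑ʳ eq)

module _ {n m : ℕ} (G : SimpleGraph n) (H : SimpleGraph m) where

  ⊕-embedˡ : Embedding G (G ⊕ H)
  ⊕-embedˡ = record { embed = _↑ˡ m ; injective = ↑ˡ-injective m _ _ ; adj-embed = adj-↑ˡ }
    where
    adj-↑ˡ : ∀ x y → adj (G ⊕ H) (x ↑ˡ m) (y ↑ˡ m) ≡ adj G x y
    adj-↑ˡ x y rewrite splitAt-↑ˡ n x m | splitAt-↑ˡ n y m = refl

  ⊕-embedʳ : Embedding H (G ⊕ H)
  ⊕-embedʳ = record { embed = n ↑ʳ_ ; injective = ↑ʳ-injective n _ _ ; adj-embed = adj-↑ʳ }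
    where
    adj-↑ʳ : ∀ x y → adj (G ⊕ H) (n ↑ʳ x) (n ↑ʳ y) ≡ adj H x y
    adj-↑ʳ x y rewrite splitAt-↑ʳ n m x | splitAt-↑ʳ n m y = refl

  ⊕-non-adj : ∀ x y → adj (G ⊕ H) (x ↑ˡ m) (n ↑ʳ y) ≡ false
  ⊕-non-adj x y rewrite splitAt-↑ˡ n x m | splitAt-↑ʳ n m y = refl

  ⊕-adj-closedˡ : ∀ {u v : Fin (n + m)} →
    InImage (_↑ˡ m) u → adj (G ⊕ H) u v ≡ true → InImage (_↑ˡ m) v
  ⊕-adj-closedˡ {v = v} (x , refl) e with summand n v
  ... | inj₁ p          = p
  ... | inj₂ (y , refl) = contradiction (trans (≡.sym (⊕-non-adj x y)) e) λ ()

  ⊕-adj-closedʳ : ∀ {u v : Fin (n + m)} →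
    InImage (n ↑ʳ_) u → adj (G ⊕ H) u v ≡ true → InImage (n ↑ʳ_) v
  ⊕-adj-closedʳ {v = v} (x , refl) e with summand n v
  ... | inj₂ p          = p
  ... | inj₁ (y , refl) =
    contradiction (trans (≡.sym (⊕-non-adj y x)) (trans (sym (G ⊕ H) _ _) e)) λ ()

  ⊕-biclique : Biclique (G ⊕ H) (suc s) (suc t) →
    Biclique G (suc s) (suc t) ⊎ Biclique H (suc s) (suc t)
  ⊕-biclique (f , g , bic@(_ , _ , _ , f~g)) with summand n (f zero)
  ... | inj₁ p = let (f∈G , g∈G) = biclique-sides (G ⊕ H) ⊕-adj-closedˡ ⊕-adj-closedˡ f~g p
                 in inj₁ (Biclique-reflect ⊕-embedˡ bic f∈G g∈G)
  ... | inj₂ p = let (f∈H , g∈H) = biclique-sides (G ⊕ H) ⊕-adj-closedʳ ⊕-adj-closedʳ f~g p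
                 in inj₂ (Biclique-reflect ⊕-embedʳ bic f∈H g∈H)

module _ {a b : ℕ} where

  K-adj-ˡˡ : ∀ x y → adj (K a b) (x ↑ˡ b) (y ↑ˡ b) ≡ false
  K-adj-ˡˡ x y rewrite splitAt-↑ˡ a x b | splitAt-↑ˡ a y b = refl

  K-adj-ʳʳ : ∀ x y → adj (K a b) (a ↑ʳ x) (a ↑ʳ y) ≡ false
  K-adj-ʳʳ x y rewrite splitAt-↑ʳ a b x | splitAt-↑ʳ a b y = refl

  K-adj-ˡʳ : ∀ x y → adj (K a b) (x ↑ˡ b) (a ↑ʳ y) ≡ true
  K-adj-ˡʳ x y rewrite splitAt-↑ˡ a x b | splitAt-↑ʳ a b y = refl

  K-adj-closedˡ : ∀ {u v : Fin (a + b)} →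
    InImage (_↑ˡ b) u → adj (K a b) u v ≡ true → InImage (a ↑ʳ_) v
  K-adj-closedˡ {v = v} (x , refl) e with summand a v
  ... | inj₂ p          = p
  ... | inj₁ (y , refl) = contradiction (trans (≡.sym (K-adj-ˡˡ x y)) e) λ ()

  K-adj-closedʳ : ∀ {u v : Fin (a + b)} →
    InImage (a ↑ʳ_) u → adj (K a b) u v ≡ true → InImage (_↑ˡ b) v
  K-adj-closedʳ {v = v} (x , refl) e with summand a v
  ... | inj₁ p          = p
  ... | inj₂ (y , refl) = contradiction (trans (≡.sym (K-adj-ʳʳ x y)) e) λ ()

  K-biclique : Biclique (K a b) a b
  K-biclique = _↑ˡ b , a ↑ʳ_ , ↑ˡ-injective b _ _ , ↑ʳ-injective a _ _ , ↑ˡ≢↑ʳ , K-adj-ˡʳ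
    where
    ↑ˡ≢↑ʳ : ∀ x y → x ↑ˡ b ≢ a ↑ʳ y
    ↑ˡ≢↑ʳ x y eq
      with () ← trans (≡.sym (splitAt-↑ˡ a x b)) (trans (cong (splitAt a) eq) (splitAt-↑ʳ a b y))

  K-biclique-side : Biclique (K a b) (suc s) (suc t) → suc s ≤ a ⊎ suc t ≤ a
  K-biclique-side (f , g , f-inj , g-inj , _ , f~g) with summand a (f zero)
  ... | inj₁ p = inj₁ (injective⇒≤ (factor-injective f-inj
                   (proj₁ (biclique-sides (K a b) K-adj-closedˡ K-adj-closedʳ f~g p))))
  ... | inj₂ p = inj₂ (injective⇒≤ (factor-injective g-inj
                   (proj₂ (biclique-sides (K a b) K-adj-closedʳ K-adj-closedˡ f~g p))))

image : (Fin m → Fin N) → Subset N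
image {zero}  f = Subset.⊥
image {suc m} f = ⁅ f zero ⁆ ∪ image (f ∘ suc)

∈-image : (f : Fin m → Fin N) → v ∈ image f → InImage f v
∈-image {zero}  f p = ⊥-elim (∉⊥ p)
∈-image {suc m} f p with x∈p∪q⁻ ⁅ f zero ⁆ (image (f ∘ suc)) p
... | inj₁ q = zero , ≡.sym (x∈⁅y⁆⇒x≡y _ q)
... | inj₂ q = let (i , fi≡v) = ∈-image (f ∘ suc) q in suc i , fi≡v

∣⁅x⁆∪p∣ : (x : Fin N) (p : Subset N) → x ∉ p → ∣ ⁅ x ⁆ ∪ p ∣ ≡ suc ∣ p ∣
∣⁅x⁆∪p∣ zero    (outside ∷ p) _   = cong suc (cong ∣_∣ (∪-identityˡ p))
∣⁅x⁆∪p∣ zero    (inside  ∷ p) x∉p = contradiction here x∉p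
∣⁅x⁆∪p∣ (suc x) (outside ∷ p) x∉p = ∣⁅x⁆∪p∣ x p (x∉p ∘ there)
∣⁅x⁆∪p∣ (suc x) (inside  ∷ p) x∉p = cong suc (∣⁅x⁆∪p∣ x p (x∉p ∘ there))

∣image∣ : {f : Fin m → Fin N} → Injective _≡_ _≡_ f → ∣ image f ∣ ≡ m
∣image∣ {zero}  {N}     _     = ∣⊥∣≡0 N
∣image∣ {suc m} {f = f} f-inj =
  trans (∣⁅x⁆∪p∣ (f zero) (image (f ∘ suc)) f₀∉rest) (cong suc (∣image∣ (suc-injective ∘ f-inj)))
  where
  f₀∉rest : f zero ∉ image (f ∘ suc)
  f₀∉rest p with () ← f-inj (proj₂ (∈-image (f ∘ suc) p))

enumerate : (p : Subset N) → Fin ∣ p ∣ → Fin N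
enumerate (inside  ∷ p) zero    = zero
enumerate (inside  ∷ p) (suc i) = suc (enumerate p i)
enumerate (outside ∷ p) i       = suc (enumerate p i)

enumerate-injective : (p : Subset N) → Injective _≡_ _≡_ (enumerate p)
enumerate-injective (inside  ∷ p) {zero}  {zero}  _  = refl
enumerate-injective (inside  ∷ p) {suc i} {suc j} eq =
  cong suc (enumerate-injective p (suc-injective eq))
enumerate-injective (outside ∷ p) eq = enumerate-injective p (suc-injective eq)

enumerate-∈ : (p : Subset N) → ∀ i → enumerate p i ∈ p
enumerate-∈ (inside  ∷ p) zero    = here
enumerate-∈ (inside  ∷ p) (suc i) = there (enumerate-∈ p i)
enumerate-∈ (outside ∷ p) i       = there (enumerate-∈ p i)

adj⇒complement-non-adj : adj H u v ≡ true → adj (complement H) u v ≡ false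
adj⇒complement-non-adj e rewrite e = refl

complement-non-adj⇒adj : {u v : Fin N} →
  u ≢ v → adj (complement H) u v ≡ false → adj H u v ≡ true
complement-non-adj⇒adj {H = H} {u} {v} u≢v e with adj H u v | u ≟ v
... | true  | _      = refl
... | false | yes eq = contradiction eq u≢v
... | false | no _   with () ← e

biclique⇒hole : (H : SimpleGraph N) → Biclique H s t → HasBipartiteHole (complement H) s t
biclique⇒hole H (f , g , f-inj , g-inj , f≢g , f~g) =
  image f , image g , ∣image∣ f-inj , ∣image∣ g-inj , disjoint , no-edge
  where
  disjoint : ∀ v → v ∈ image f → v ∈ image g → ⊥
  disjoint v p q with ∈-image f p | ∈-image g q
  ... | i , refl | j , gj≡fi = f≢g i j (≡.sym gj≡fi)

  no-edge : ∀ u v → u ∈ image f → v ∈ image g → adj (complement H) u v ≡ false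
  no-edge u v p q with ∈-image f p | ∈-image g q
  ... | i , refl | j , refl = adj⇒complement-non-adj {H = H} (f~g i j)

hole⇒biclique : (H : SimpleGraph N) → HasBipartiteHole (complement H) s t → Biclique H s t
hole⇒biclique H (S , T , refl , refl , S∩T≡∅ , no-edge) =
  enumerate S , enumerate T , enumerate-injective S , enumerate-injective T , distinct ,
  λ i j → complement-non-adj⇒adj {H = H} (distinct i j)
                                   (no-edge _ _ (enumerate-∈ S i) (enumerate-∈ T j))
  where
  distinct : ∀ i j → enumerate S i ≢ enumerate T j
  distinct i j eq = S∩T≡∅ _ (enumerate-∈ S i) (subst (_∈ T) (≡.sym eq) (enumerate-∈ T j))

hole? : (F : SimpleGraph N) → ∀ s t → Dec (HasBipartiteHole F s t)
hole? F s t = anySubset? λ S → anySubset? λ T →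
  (∣ S ∣ ℕ.≟ s) ×-dec (∣ T ∣ ℕ.≟ t) ×-dec
  all? (λ v → (v ∈? S) →-dec (v ∈? T) →-dec no λ ()) ×-dec
  all? (λ u → all? λ v → (u ∈? S) →-dec (v ∈? T) →-dec (adj F u v Bool.≟ false))

hole-size-≤ : (F : SimpleGraph N) → HasBipartiteHole F s t → s ≤ N
hole-size-≤ F (S , _ , refl , _) = ∣p∣≤n S

-- IsBipartiteHoleNumber F r says that r is the least element of HoleFreeAt F.
HoleFreeAt : SimpleGraph N → ℕ → Set
HoleFreeAt F r = ∃[ s ] ∃[ t ] (1 ≤ s × 1 ≤ t × r ≡ s + t ∸ 1 × ¬ HasBipartiteHole F s t)

bounded-∃? : {P : ℕ → Set} → Decidable P → ∀ b → Dec (∃ λ x → x ≤ b × P x)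
bounded-∃? {P = P} P? b =
  map′ (λ (i , p) → toℕ i , toℕ≤pred[n] i , p)
       (λ (x , x≤b , p) → fromℕ< (s≤s x≤b) , subst P (≡.sym (toℕ-fromℕ< (s≤s x≤b))) p)
       (any? (P? ∘ toℕ))

holeFreeAt? : (F : SimpleGraph N) → Decidable (HoleFreeAt F)
holeFreeAt? F r =
  map′ (λ (s , _ , t , _ , w) → s , t , w) (λ (s , t , w) → s , s≤r w , t , t≤r w , w)
       (bounded-∃? (λ s → bounded-∃? (λ t →
          (1 ≤? s) ×-dec (1 ≤? t) ×-dec (r ℕ.≟ s + t ∸ 1) ×-dec ¬? (hole? F s t)) r) r)
  where
  s≤r : ∀ {s t} → 1 ≤ s × 1 ≤ t × r ≡ s + t ∸ 1 × ¬ HasBipartiteHole F s t → s ≤ r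
  s≤r {s} {suc t} (_ , _ , refl , _) rewrite +-suc s t = m≤m+n s t
  t≤r : ∀ {s t} → 1 ≤ s × 1 ≤ t × r ≡ s + t ∸ 1 × ¬ HasBipartiteHole F s t → t ≤ r
  t≤r {suc s} {t} (_ , _ , refl , _) = m≤n+m t s

Least : (ℕ → Set) → ℕ → Set
Least P r = P r × (∀ j → P j → r ≤ j)

least-below : {P : ℕ → Set} → Decidable P → ∀ b → (∀ j → j < b → ¬ P j) ⊎ ∃ (Least P)
least-below P? zero = inj₁ λ _ ()
least-below P? (suc b) with least-below P? b
... | inj₂ r = inj₂ r
... | inj₁ none-below with P? b
...   | yes p  = inj₂ (b , p , λ j pj → ≮⇒≥ λ j<b → none-below j j<b pj)
...   | no  ¬p = inj₁ λ j j<1+b →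
                   [ none-below j , (λ { refl → ¬p }) ]′ (m<1+n⇒m<n∨m≡n j<1+b)

least : {P : ℕ → Set} → Decidable P → P m → ∃ (Least P)
least {m} P? p = [ (λ none → contradiction p (none m ≤-refl)) , id ]′ (least-below P? (suc m))

bipartiteHoleNumber : (F : SimpleGraph N) → Σ ℕ (IsBipartiteHoleNumber F)
bipartiteHoleNumber {N} F with least (holeFreeAt? F) (suc N , 1 , s≤s z≤n , s≤s z≤n ,
                                 ≡.sym (m+n∸n≡m (suc N) 1) , 1+n≰n ∘ hole-size-≤ F)
... | r , free , minimal =
  r , free , λ s t 1≤s 1≤t ¬hole → minimal _ (s , t , 1≤s , 1≤t , refl , ¬hole)

bipartiteHoleNumber-≥ : (F : SimpleGraph N) {r : ℕ} → IsBipartiteHoleNumber F r →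
  (∀ s t → 1 ≤ s → 1 ≤ t → s + t ≤ m → HasBipartiteHole F s t) → m ≤ r
-- Matching 1 ≤ s against s≤s z≤n lets s + t ∸ 1 compute to pred (s + t).
bipartiteHoleNumber-≥ F ((s , t , 1≤s@(s≤s z≤n) , 1≤t , refl , ¬hole) , _) holes =
  <⇒≤pred (≰⇒> λ s+t≤m → ¬hole (holes s t 1≤s 1≤t s+t≤m))

hole-below-bipartiteHoleNumber : (F : SimpleGraph N) {r : ℕ} → IsBipartiteHoleNumber F r →
  1 ≤ s → 1 ≤ t → s + t ≤ r → HasBipartiteHole F s t
hole-below-bipartiteHoleNumber {s = s} {t = t} F (_ , minimal) 1≤s@(s≤s z≤n) 1≤t s+t≤r =
  decidable-stable (hole? F s t) λ ¬hole → 1+n≰n (≤-trans s+t≤r (minimal s t 1≤s 1≤t ¬hole))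

2*n≡n+n : ∀ n → 2 * n ≡ n + n
2*n≡n+n n = cong (n +_) (+-identityʳ n)

k<s⇒t≤k∸1 : k < s → s + t ≤ 2 * k → t ≤ k ∸ 1
k<s⇒t≤k∸1 {k} {s} {t} k<s s+t≤2k = <⇒≤pred (+-cancelʳ-≤ k (suc t) k (begin
  suc t + k  ≡⟨ +-suc t k ⟨
  t + suc k  ≤⟨ +-monoʳ-≤ t k<s ⟩
  t + s      ≡⟨ +-comm t s ⟩
  s + t      ≤⟨ s+t≤2k ⟩
  2 * k      ≡⟨ 2*n≡n+n k ⟩
  k + k      ∎))
  where open ≤-Reasoning

⊕K-biclique : Biclique G k k → s + t ≤ 2 * k → Biclique (G ⊕ K (k ∸ 1) (2 * k)) s t
⊕K-biclique {G = G} {k} {s} {t} b s+t≤2k with s ≤? k | t ≤? k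
... | yes s≤k | yes t≤k = Biclique-map (⊕-embedˡ G _) (Biclique-shrink G s≤k t≤k b)
... | no  s≰k | _       = Biclique-map (⊕-embedʳ G _) (Biclique-swap (K (k ∸ 1) (2 * k))
    (Biclique-shrink (K (k ∸ 1) (2 * k))
      (k<s⇒t≤k∸1 (≰⇒> s≰k) s+t≤2k) (≤-trans (m≤m+n s t) s+t≤2k) K-biclique))
... | yes _   | no t≰k  = Biclique-map (⊕-embedʳ G _)
    (Biclique-shrink (K (k ∸ 1) (2 * k))
      (k<s⇒t≤k∸1 (≰⇒> t≰k) (subst (_≤ 2 * k) (+-comm s t) s+t≤2k))
      (≤-trans (m≤n+m t s) s+t≤2k) K-biclique)

lemma4 : {n : ℕ} (G : SimpleGraph n) (k : ℕ) → 1 ≤ k →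
    ContainsKkk G k ⇔ Σ ℕ (λ r → IsBipartiteHoleNumber (Gphi G k) r × 2 * k ≤ r)
lemma4 G (suc k) 1≤k = mk⇔ forward backward
  where
  G′ = G ⊕ K k (2 * suc k)
  F = Gphi G (suc k)

  forward : Biclique G (suc k) (suc k) → Σ ℕ (λ r → IsBipartiteHoleNumber F r × 2 * suc k ≤ r)
  forward b = let (r , isNumber) = bipartiteHoleNumber F in
    r , isNumber , bipartiteHoleNumber-≥ F isNumber λ _ _ _ _ s+t≤2k →
                     biclique⇒hole G′ (⊕K-biclique b s+t≤2k)

  backward : Σ ℕ (λ r → IsBipartiteHoleNumber F r × 2 * suc k ≤ r) → Biclique G (suc k) (suc k)
  backward (r , isNumber , 2k≤r) =
    [ id , (λ inK → ⊥-elim ([ 1+n≰n , 1+n≰n ]′ (K-biclique-side inK))) ]′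
      (⊕-biclique G (K k _) (hole⇒biclique G′ hole))
    where
    hole : HasBipartiteHole F (suc k) (suc k)
    hole = hole-below-bipartiteHoleNumber F isNumber 1≤k 1≤k (subst (_≤ r) (2*n≡n+n (suc k)) 2k≤r)
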